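{- Let $\langle R,X\rangle$ and $\langle S,Y\rangle$ be relations with $X\cap Y=\emptyset$. Then $\langle R,X\rangle$ and $\langle S,Y\rangle$ are both trifunctional iff $\langle R,X\rangle+\langle S,Y\rangle$ is trifunctional; and $\langle R,X\rangle$ and $\langle S,Y\rangle$ are both trifunctional iff $\langle R,X\rangle\cdot\langle S,Y\rangle$ is trifunctional.
   Context: A relation is a pair $\langle R,X\rangle$ with $R\subseteq X^2$. For $X\cap Y=\emptyset$, $\langle R,X\rangle+\langle S,Y\rangle=\langle R\cup S,X\cup Y\rangle$ and $\langle R,X\rangle\cdot\langle S,Y\rangle=\langle R\cup S\cup(X\times Y),X\cup Y\rangle$. A relation $\langle R,X\rangle$ is trifunctional if for all $x,y,z,u\in X$: if $(x,z),(y,z),(y,u)\in R$ then $(x,u)\in R$ or $(y,x)\in R$ or $(u,z)\in R$. -}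

module Defs where

open import Level using (Level; _⊔_; Lift)
open import Data.Sum using (_⊎_; inj₁; inj₂)
open import Data.Unit using (⊤)
open import Data.Empty using (⊥)
open import Relation.Binary.Core using (Rel)

Trifunctional : ∀ {a ℓ} {X : Set a} → Rel X ℓ → Set (a ⊔ ℓ)
Trifunctional {X = X} R =
  ∀ (x y z u : X) → R x z → R y z → R y u → R x u ⊎ (R y x ⊎ R u z)

-- Disjoint carriers X, Y are modelled by the disjoint union X ⊎ Y.

-- ⟨R,X⟩ + ⟨S,Y⟩ = ⟨R ∪ S, X ∪ Y⟩
_⊕_ : ∀ {a b ℓ} {X : Set a} {Y : Set b} → Rel X ℓ → Rel Y ℓ → Rel (X ⊎ Y) ℓ
(R ⊕ S) (inj₁ x) (inj₁ x′) = R x x′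
(R ⊕ S) (inj₂ y) (inj₂ y′) = S y y′
(R ⊕ S) (inj₁ x) (inj₂ y)  = Lift _ ⊥
(R ⊕ S) (inj₂ y) (inj₁ x)  = Lift _ ⊥

-- ⟨R,X⟩ · ⟨S,Y⟩ = ⟨R ∪ S ∪ (X × Y), X ∪ Y⟩
_⊗_ : ∀ {a b ℓ} {X : Set a} {Y : Set b} → Rel X ℓ → Rel Y ℓ → Rel (X ⊎ Y) ℓ
(R ⊗ S) (inj₁ x) (inj₁ x′) = R x x′
(R ⊗ S) (inj₂ y) (inj₂ y′) = S y y′
(R ⊗ S) (inj₁ x) (inj₂ y)  = Lift _ ⊤
(R ⊗ S) (inj₂ y) (inj₁ x)  = Lift _ ⊥

-- • Necessity: trifunctionality is inherited by any relation that embeds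
--   into a trifunctional one (a map preserving and reflecting the
--   relation).  The injections inj₁ and inj₂ are such embeddings of R and
--   S into both R ⊕ S and R ⊗ S.
--
-- In every mixed
--   quadruple either a hypothesis is a missing cross edge (absurd), or one
--   of the three conclusions is a cross edge X → Y, which is present in
--   R ⊗ S by definition (and never needed in R ⊕ S, where every mixed
--   quadruple is absurd).

module Submission where

open import Defs
open import Level using (lift)
open import Data.Product using (_×_; _,_)
open import Data.Sum using (_⊎_; inj₁; inj₂)
open import Function.Base using (id)
open import Function.Bundles using (_⇔_; mk⇔)
open import Relation.Binary.Core using (Rel)

trifunctional-embedding :
  ∀ {a c ℓ ℓ′} {X : Set a} {Z : Set c} {R : Rel X ℓ} {T : Rel Z ℓ′}
  (f : X → Z) →
  (∀ {x x′} → R x x′ → T (f x) (f x′)) →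
  (∀ {x x′} → T (f x) (f x′) → R x x′) →
  Trifunctional T → Trifunctional R
trifunctional-embedding f preserve reflect tT x y z u xz yz yu
  with tT (f x) (f y) (f z) (f u) (preserve xz) (preserve yz) (preserve yu)
... | inj₁ xu        = inj₁ (reflect xu)
... | inj₂ (inj₁ yx) = inj₂ (inj₁ (reflect yx))
... | inj₂ (inj₂ uz) = inj₂ (inj₂ (reflect uz))

module _ {a b ℓ} {X : Set a} {Y : Set b} (R : Rel X ℓ) (S : Rel Y ℓ) where

  -- For R ⊕ S and R ⊗ S the four
  -- restriction maps are identities, since both agree with R and S there.
  summands-trifunctional :
    (T : Rel (X ⊎ Y) ℓ) →
    (∀ {x x′} → T (inj₁ x) (inj₁ x′) → R x x′) →
    (∀ {x x′} → R x x′ → T (inj₁ x) (inj₁ x′)) →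
    (∀ {y y′} → T (inj₂ y) (inj₂ y′) → S y y′) →
    (∀ {y y′} → S y y′ → T (inj₂ y) (inj₂ y′)) →
    Trifunctional T → Trifunctional R × Trifunctional S
  summands-trifunctional T reflectR preserveR reflectS preserveS tT =
      trifunctional-embedding inj₁ preserveR reflectR tT
    , trifunctional-embedding inj₂ preserveS reflectS tT

  -- The disjoint sum has no cross edges, so every mixed quadruple has an
  -- absent hypothesis edge.
  sum-trifunctional :
    Trifunctional R × Trifunctional S → Trifunctional (R ⊕ S)
  sum-trifunctional (tR , tS) (inj₁ x) (inj₁ y) (inj₁ z) (inj₁ u) = tR x y z u
  sum-trifunctional (tR , tS) (inj₂ x) (inj₂ y) (inj₂ z) (inj₂ u) = tS x y z u
  sum-trifunctional _ (inj₁ _) (inj₁ _) (inj₁ _) (inj₂ _) _ _ (lift ())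
  sum-trifunctional _ (inj₁ _) (inj₁ _) (inj₂ _) _ (lift ()) _ _
  sum-trifunctional _ (inj₁ _) (inj₂ _) (inj₁ _) _ _ (lift ()) _
  sum-trifunctional _ (inj₁ _) (inj₂ _) (inj₂ _) _ (lift ()) _ _
  sum-trifunctional _ (inj₂ _) _ (inj₁ _) _ (lift ()) _ _
  sum-trifunctional _ (inj₂ _) (inj₁ _) (inj₂ _) _ _ (lift ()) _
  sum-trifunctional _ (inj₂ _) (inj₂ _) (inj₂ _) (inj₁ _) _ _ (lift ())

  -- In the ordinal product every edge X → Y is present and no edge
  -- Y → X is: a mixed quadruple either needs a missing Y → X edge as a
  -- hypothesis, or has one of  x u,  y x,  u z  as an X → Y edge.
  product-trifunctional :
    Trifunctional R × Trifunctional S → Trifunctional (R ⊗ S)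
  product-trifunctional (tR , tS) (inj₁ x) (inj₁ y) (inj₁ z) (inj₁ u) = tR x y z u
  product-trifunctional (tR , tS) (inj₂ x) (inj₂ y) (inj₂ z) (inj₂ u) = tS x y z u
  product-trifunctional _ (inj₁ _) _ _ (inj₂ _) _ _ _ = inj₁ (lift _)
  product-trifunctional _ (inj₁ _) (inj₁ _) (inj₂ _) (inj₁ _) _ _ _ = inj₂ (inj₂ (lift _))
  product-trifunctional _ (inj₂ _) (inj₁ _) (inj₂ _) (inj₁ _) _ _ _ = inj₂ (inj₂ (lift _))
  product-trifunctional _ (inj₂ _) (inj₁ _) (inj₂ _) (inj₂ _) _ _ _ = inj₂ (inj₁ (lift _))
  product-trifunctional _ (inj₁ _) (inj₂ _) (inj₁ _) (inj₁ _) _ (lift ()) _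
  product-trifunctional _ (inj₁ _) (inj₂ _) (inj₂ _) (inj₁ _) _ _ (lift ())
  product-trifunctional _ (inj₂ _) _ (inj₁ _) _ (lift ()) _ _
  product-trifunctional _ (inj₂ _) (inj₂ _) (inj₂ _) (inj₁ _) _ _ (lift ())

proposition2p2 : ∀ {a b ℓ} {X : Set a} {Y : Set b} (R : Rel X ℓ) (S : Rel Y ℓ) →
    ((Trifunctional R × Trifunctional S) ⇔ Trifunctional (R ⊕ S))
    × ((Trifunctional R × Trifunctional S) ⇔ Trifunctional (R ⊗ S))
proposition2p2 R S =
    mk⇔ (sum-trifunctional R S)
        (summands-trifunctional R S (R ⊕ S) id id id id)
  , mk⇔ (product-trifunctional R S)
        (summands-trifunctional R S (R ⊗ S) id id id id)
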